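{- Let $q,q'$ be positive integers with $q\equiv q'\equiv0\pmod4$ and $H=C_q\bowtie C_{q'}$. Then $\chi'_2(H)\le6$.
   Context: For even $q$, $C_q$ is regarded as a balanced bipartite graph with $V=(v_1,\dots,v_{q/2})$, $U=(u_1,\dots,u_{q/2})$ and edges $v_iu_i$ and $v_{i+1}u_i$ for all $i$ (indices modulo $q/2$). For balanced bipartite graphs $G_1=(V_1\cup U_1,E_1)$, $G_2=(V_2\cup U_2,E_2)$ with orderings $V_i=(v^i_1,\dots,v^i_{n_i})$, $U_i=(u^i_1,\dots,u^i_{n_i})$, the balanced bipartite product $G_1\bowtie G_2$ has vertex set $V_1\times V_2\cup U_1\times U_2$ and edge set $\{(v^1_j,v^2)(u^1_j,u^2): j\in[n_1],\ v^2u^2\in E_2\}\cup\{(v^1,v^2_j)(u^1,u^2_j): j\in[n_2],\ v^1u^1\in E_1\}$. $\chi'_2(H)$ is the least number of colours in an edge-colouring of $H$ in which any two distinct edges at distance at most $2$ in the line graph $L(H)$ receive distinct colours (i.e. edges that share a vertex or are joined by an edge get distinct colours). -}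

module Defs where

open import Data.Nat using (ℕ; zero; suc; _/_)
open import Data.Fin using (Fin; toℕ)
open import Data.Product using (_×_; _,_; Σ)
open import Data.Sum using (_⊎_)
open import Relation.Binary.PropositionalEquality using (_≡_; _≢_)
open import Relation.Nullary using (¬_)

-- A balanced bipartite graph with ordered parts V = (v_0,…,v_{n-1}),
-- U = (u_0,…,u_{n-1}); vertex v_i is identified with i : Fin n on the
-- V side and u_j with j : Fin n on the U side.  Adj i j means v_i u_j ∈ E.
record BBGraph : Set₁ where
  field
    n   : ℕ
    Adj : Fin n → Fin n → Set

record BipGraph : Set₁ where
  field
    V   : Set
    U   : Set
    Adj : V → U → Set

-- Cycle C_{2m} as a balanced bipartite graph on m + m vertices:
-- edges v_i u_i and v_{i+1} u_i (indices mod m; 0-based here).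
cycleAdj : (m : ℕ) → Fin m → Fin m → Set
cycleAdj m i j =
  (i ≡ j) ⊎ ((toℕ i ≡ suc (toℕ j)) ⊎ ((toℕ i ≡ 0) × (suc (toℕ j) ≡ m)))

C : ℕ → BBGraph
C q = record { n = q / 2 ; Adj = cycleAdj (q / 2) }

-- Balanced bipartite product G₁ ⋈ G₂.
-- (v¹,v²) ~ (u¹,u²)  iff  (v¹ = v¹_j, u¹ = u¹_j for some j, and v²u² ∈ E₂)
--                      or (v² = v²_j, u² = u²_j for some j, and v¹u¹ ∈ E₁).
_⋈_ : BBGraph → BBGraph → BipGraph
G₁ ⋈ G₂ = record
  { V   = Fin (BBGraph.n G₁) × Fin (BBGraph.n G₂)
  ; U   = Fin (BBGraph.n G₁) × Fin (BBGraph.n G₂)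
  ; Adj = λ { (a , b) (c , d) →
              ((a ≡ c) × BBGraph.Adj G₂ b d) ⊎ ((b ≡ d) × BBGraph.Adj G₁ a c) }
  }

-- A strong edge colouring with k colours: a colour for each edge
-- (an edge is determined by its endpoints x ∈ V, y ∈ U; values on
-- non-edges are irrelevant) such that two distinct edges at distance
-- ≤ 2 in the line graph (sharing a vertex, or joined by an edge)
-- get different colours.
IsStrongEdgeColouring : (H : BipGraph) (k : ℕ) →
  (BipGraph.V H → BipGraph.U H → Fin k) → Set
IsStrongEdgeColouring H k c =
  ∀ (x x' : V) (y y' : U) → Adj x y → Adj x' y' →
  ¬ ((x ≡ x') × (y ≡ y')) →
  ((x ≡ x') ⊎ (y ≡ y') ⊎ Adj x y' ⊎ Adj x' y) →
  c x y ≢ c x' y'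
  where open BipGraph H

χ'₂≤ : BipGraph → ℕ → Set
χ'₂≤ H k = Σ (BipGraph.V H → BipGraph.U H → Fin k) (IsStrongEdgeColouring H k)

{-# OPTIONS --safe #-}
module Submission where

-- Reducing indices modulo 2 maps C q onto C 4 = K₂,₂ when 4 ∣ q.  This map is injective on
-- every neighbourhood and sends a non-matching edge vᵢ₊₁uᵢ to a non-matching edge (the
-- wrap-around edge v₀u_{q/2-1} included, as q/2 is even), so on C q ⋈ C q' it induces a
-- homomorphism to C 4 ⋈ C 4 that is injective on neighbourhoods.  Strong edge colourings pull
-- back along such maps: two close edges with the same image coincide.  Finally C 4 ⋈ C 4 is
-- K₄,₄ minus a perfect matching, whose strong 6-colouring is checked by computation.

open import Defs
open import Data.Nat as ℕ using (ℕ; _<_; suc; _/_; parity)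
open import Data.Nat.Divisibility using (_∣_; divides-refl; m*n∣o⇒m∣o/n)
open import Data.Nat.Properties using (suc-injective; 1+n≢0; <⇒≢)
open import Data.Parity.Base using (Parity; 0ℙ; 1ℙ)
open import Data.Parity.Properties using (p≢p⁻¹; suc-homo-⁻¹; *-homo-*; *-zeroʳ)
open import Data.Fin as Fin using (Fin; toℕ; combine; #_) renaming (zero to 0F; suc to sucF)
open import Data.Fin.Properties using (toℕ-injective; toℕ<n; all?)
open import Data.Product using (_×_; _,_) renaming (map to map×)
open import Data.Product.Properties using (≡-dec; ,-injectiveˡ; ,-injectiveʳ)
open import Data.Sum using (_⊎_; inj₁; inj₂)
open import Data.Bool using (if_then_else_)
open import Relation.Binary.Definitions using (Decidable)
open import Relation.Binary.PropositionalEquality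
  using (_≡_; _≢_; refl; sym; trans; cong; cong₂; module ≡-Reasoning)
open import Relation.Nullary using (Dec; yes; no; does; ¬?; contradiction)
open import Relation.Nullary.Decidable using (_×-dec_; _⊎-dec_; _→-dec_; map′; from-yes)

Close : (H : BipGraph) → BipGraph.V H → BipGraph.U H → BipGraph.V H → BipGraph.U H → Set
Close H x y x' y' = (x ≡ x') ⊎ (y ≡ y') ⊎ Adj x y' ⊎ Adj x' y
  where open BipGraph H

module _ (H₁ H₂ : BipGraph) where
  private
    module H₁ = BipGraph H₁
    module H₂ = BipGraph H₂

  record LocalInjection : Set where
    field
      mapᵛ : H₁.V → H₂.V
      mapᵘ : H₁.U → H₂.U
      preserves-adj : ∀ {x y} → H₁.Adj x y → H₂.Adj (mapᵛ x) (mapᵘ y)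
      injectiveᵘ : ∀ {x y y'} → H₁.Adj x y → H₁.Adj x y' → mapᵘ y ≡ mapᵘ y' → y ≡ y'
      injectiveᵛ : ∀ {x x' y} → H₁.Adj x y → H₁.Adj x' y → mapᵛ x ≡ mapᵛ x' → x ≡ x'

module _ {H₁ H₂ : BipGraph} (φ : LocalInjection H₁ H₂) where
  open LocalInjection φ
  private
    module H₁ = BipGraph H₁

  preserves-close : ∀ {x x' y y'} → Close H₁ x y x' y' →
    Close H₂ (mapᵛ x) (mapᵘ y) (mapᵛ x') (mapᵘ y')
  preserves-close (inj₁ x≡x')              = inj₁ (cong mapᵛ x≡x')
  preserves-close (inj₂ (inj₁ y≡y'))       = inj₂ (inj₁ (cong mapᵘ y≡y'))
  preserves-close (inj₂ (inj₂ (inj₁ xy'))) = inj₂ (inj₂ (inj₁ (preserves-adj xy')))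
  preserves-close (inj₂ (inj₂ (inj₂ x'y))) = inj₂ (inj₂ (inj₂ (preserves-adj x'y)))

  close∧same-image⇒same-edge : ∀ {x x' y y'} → H₁.Adj x y → H₁.Adj x' y' →
    mapᵛ x ≡ mapᵛ x' → mapᵘ y ≡ mapᵘ y' → Close H₁ x y x' y' → x ≡ x' × y ≡ y'
  close∧same-image⇒same-edge xy x'y' _ fy≡fy' (inj₁ refl) =
    refl , injectiveᵘ xy x'y' fy≡fy'
  close∧same-image⇒same-edge xy x'y' fx≡fx' _ (inj₂ (inj₁ refl)) =
    injectiveᵛ xy x'y' fx≡fx' , refl
  close∧same-image⇒same-edge xy x'y' fx≡fx' fy≡fy' (inj₂ (inj₂ (inj₁ xy'))) =
    injectiveᵛ xy' x'y' fx≡fx' , injectiveᵘ xy xy' fy≡fy'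
  close∧same-image⇒same-edge xy x'y' fx≡fx' fy≡fy' (inj₂ (inj₂ (inj₂ x'y))) =
    injectiveᵛ xy x'y fx≡fx' , injectiveᵘ x'y x'y' fy≡fy'

  pullback-isStrongEdgeColouring : ∀ {k c} → IsStrongEdgeColouring H₂ k c →
    IsStrongEdgeColouring H₁ k (λ x y → c (mapᵛ x) (mapᵘ y))
  pullback-isStrongEdgeColouring strong x x' y y' xy x'y' distinct close same-colour =
    strong _ _ _ _ (preserves-adj xy) (preserves-adj x'y')
      (λ (fx≡fx' , fy≡fy') →
        distinct (close∧same-image⇒same-edge xy x'y' fx≡fx' fy≡fy' close))
      (preserves-close close) same-colour

  χ'₂≤-pullback : ∀ {k} → χ'₂≤ H₂ k → χ'₂≤ H₁ k
  χ'₂≤-pullback (c , strong) = _ , pullback-isStrongEdgeColouring strong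

module _ (G₁ G₂ : BBGraph) where
  private
    module G₁ = BBGraph G₁
    module G₂ = BBGraph G₂

  record BBLocalInjection : Set where
    field
      map : Fin G₁.n → Fin G₂.n
      preserves-adj : ∀ {i j} → G₁.Adj i j → G₂.Adj (map i) (map j)
      -- ⋈ pairs vᵢ with uᵢ, so an edge may go to a matching edge vₖuₖ only if it is one.
      reflects-diagonal : ∀ {i j} → G₁.Adj i j → map i ≡ map j → i ≡ j
      injectiveᵘ : ∀ {i j j'} → G₁.Adj i j → G₁.Adj i j' → map j ≡ map j' → j ≡ j'
      injectiveᵛ : ∀ {i i' j} → G₁.Adj i j → G₁.Adj i' j → map i ≡ map i' → i ≡ i'

⋈-localInjection : ∀ {G₁ G₂ G₁' G₂'} → BBLocalInjection G₁ G₂ → BBLocalInjection G₁' G₂' →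
  LocalInjection (G₁ ⋈ G₁') (G₂ ⋈ G₂')
⋈-localInjection {G₁} {G₂} {G₁'} {G₂'} φ φ' = record
  { mapᵛ          = map× f f'
  ; mapᵘ          = map× f f'
  ; preserves-adj = preserves-adj⋈
  ; injectiveᵘ    = injectiveᵘ⋈
  ; injectiveᵛ    = injectiveᵛ⋈
  }
  where
  open BBLocalInjection φ renaming (map to f)
  open BBLocalInjection φ' renaming (map to f'; preserves-adj to preserves-adj';
    reflects-diagonal to reflects-diagonal'; injectiveᵘ to injectiveᵘ'; injectiveᵛ to injectiveᵛ')
  open BipGraph (G₁ ⋈ G₁') using (Adj)

  preserves-adj⋈ : ∀ {x y} → Adj x y → BipGraph.Adj (G₂ ⋈ G₂') (map× f f' x) (map× f f' y)
  preserves-adj⋈ (inj₁ (refl , bd)) = inj₁ (refl , preserves-adj' bd)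
  preserves-adj⋈ (inj₂ (refl , ac)) = inj₂ (refl , preserves-adj ac)

  injectiveᵘ⋈ : ∀ {x y y'} → Adj x y → Adj x y' → map× f f' y ≡ map× f f' y' → y ≡ y'
  injectiveᵘ⋈ (inj₁ (refl , bd)) (inj₁ (refl , bd')) eq =
    cong (_ ,_) (injectiveᵘ' bd bd' (,-injectiveʳ eq))
  injectiveᵘ⋈ (inj₁ (refl , bd)) (inj₂ (refl , ac')) eq = cong₂ _,_
    (reflects-diagonal ac' (,-injectiveˡ eq))
    (sym (reflects-diagonal' bd (sym (,-injectiveʳ eq))))
  injectiveᵘ⋈ (inj₂ (refl , ac)) (inj₁ (refl , bd')) eq = cong₂ _,_
    (sym (reflects-diagonal ac (sym (,-injectiveˡ eq))))
    (reflects-diagonal' bd' (,-injectiveʳ eq))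
  injectiveᵘ⋈ (inj₂ (refl , ac)) (inj₂ (refl , ac')) eq =
    cong (_, _) (injectiveᵘ ac ac' (,-injectiveˡ eq))

  injectiveᵛ⋈ : ∀ {x x' y} → Adj x y → Adj x' y → map× f f' x ≡ map× f f' x' → x ≡ x'
  injectiveᵛ⋈ (inj₁ (refl , bd)) (inj₁ (refl , b'd)) eq =
    cong (_ ,_) (injectiveᵛ' bd b'd (,-injectiveʳ eq))
  injectiveᵛ⋈ (inj₁ (refl , bd)) (inj₂ (refl , a'c)) eq = cong₂ _,_
    (sym (reflects-diagonal a'c (sym (,-injectiveˡ eq))))
    (reflects-diagonal' bd (,-injectiveʳ eq))
  injectiveᵛ⋈ (inj₂ (refl , ac)) (inj₁ (refl , b'd)) eq = cong₂ _,_
    (reflects-diagonal ac (,-injectiveˡ eq))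
    (sym (reflects-diagonal' b'd (sym (,-injectiveʳ eq))))
  injectiveᵛ⋈ (inj₂ (refl , ac)) (inj₂ (refl , a'c)) eq =
    cong (_, _) (injectiveᵛ ac a'c (,-injectiveˡ eq))

CyclicSucc : (m : ℕ) → Fin m → Fin m → Set
CyclicSucc m i j = (toℕ i ≡ suc (toℕ j)) ⊎ ((toℕ i ≡ 0) × (suc (toℕ j) ≡ m))

module _ {m : ℕ} where

  cyclicSucc-functional : ∀ {i j j' : Fin m} → CyclicSucc m i j → CyclicSucc m i j' → j ≡ j'
  cyclicSucc-functional (inj₁ i≡1+j) (inj₁ i≡1+j') =
    toℕ-injective (suc-injective (trans (sym i≡1+j) i≡1+j'))
  cyclicSucc-functional (inj₁ i≡1+j) (inj₂ (i≡0 , _)) =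
    contradiction (trans (sym i≡1+j) i≡0) 1+n≢0
  cyclicSucc-functional (inj₂ (i≡0 , _)) (inj₁ i≡1+j') =
    contradiction (trans (sym i≡1+j') i≡0) 1+n≢0
  cyclicSucc-functional (inj₂ (_ , 1+j≡m)) (inj₂ (_ , 1+j'≡m)) =
    toℕ-injective (suc-injective (trans 1+j≡m (sym 1+j'≡m)))

  cyclicSucc-injective : ∀ {i i' j : Fin m} → CyclicSucc m i j → CyclicSucc m i' j → i ≡ i'
  cyclicSucc-injective (inj₁ i≡1+j) (inj₁ i'≡1+j) =
    toℕ-injective (trans i≡1+j (sym i'≡1+j))
  cyclicSucc-injective {i} (inj₁ i≡1+j) (inj₂ (_ , 1+j≡m)) =
    contradiction (trans i≡1+j 1+j≡m) (<⇒≢ (toℕ<n i))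
  cyclicSucc-injective {i' = i'} (inj₂ (_ , 1+j≡m)) (inj₁ i'≡1+j) =
    contradiction (trans i'≡1+j 1+j≡m) (<⇒≢ (toℕ<n i'))
  cyclicSucc-injective (inj₂ (i≡0 , _)) (inj₂ (i'≡0 , _)) =
    toℕ-injective (trans i≡0 (sym i'≡0))

parity-suc≢ : ∀ n → parity (suc n) ≢ parity n
parity-suc≢ n eq = p≢p⁻¹ (parity (suc n)) (trans eq (sym (suc-homo-⁻¹ n)))

2∣⇒parity≡0ℙ : ∀ {m} → 2 ∣ m → parity m ≡ 0ℙ
2∣⇒parity≡0ℙ (divides-refl p) = trans (*-homo-* p 2) (*-zeroʳ (parity p))

module _ {m : ℕ} (m-even : parity m ≡ 0ℙ) where

  cyclicSucc⇒parity≢ : ∀ {i j : Fin m} → CyclicSucc m i j → parity (toℕ i) ≢ parity (toℕ j)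
  cyclicSucc⇒parity≢ {j = j} (inj₁ i≡1+j) πi≡πj =
    parity-suc≢ (toℕ j) (trans (cong parity (sym i≡1+j)) πi≡πj)
  cyclicSucc⇒parity≢ {i} {j} (inj₂ (i≡0 , 1+j≡m)) πi≡πj = parity-suc≢ (toℕ j) (begin
    parity (suc (toℕ j)) ≡⟨ cong parity 1+j≡m ⟩
    parity m             ≡⟨ m-even ⟩
    parity 0             ≡⟨ cong parity (sym i≡0) ⟩
    parity (toℕ i)       ≡⟨ πi≡πj ⟩
    parity (toℕ j)       ∎)
    where open ≡-Reasoning

fromParity : Parity → Fin 2
fromParity 0ℙ = 0F
fromParity 1ℙ = sucF 0F

fromParity-injective : ∀ {p p'} → fromParity p ≡ fromParity p' → p ≡ p'
fromParity-injective {0ℙ} {0ℙ} _ = refl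
fromParity-injective {1ℙ} {1ℙ} _ = refl

C₄-complete : ∀ i j → BBGraph.Adj (C 4) i j
C₄-complete 0F 0F = inj₁ refl
C₄-complete 0F (sucF 0F) = inj₂ (inj₂ (refl , refl))
C₄-complete (sucF 0F) 0F = inj₂ (inj₁ refl)
C₄-complete (sucF 0F) (sucF 0F) = inj₁ refl

parity-localInjection : ∀ q → parity (q / 2) ≡ 0ℙ → BBLocalInjection (C q) (C 4)
parity-localInjection q half-even = record
  { map = π
  ; preserves-adj = λ {i} {j} _ → C₄-complete (π i) (π j)
  ; reflects-diagonal = reflects-diagonal
  ; injectiveᵘ = injectiveᵘ
  ; injectiveᵛ = injectiveᵛ
  }
  where
  m = q / 2
  π : Fin m → Fin 2
  π i = fromParity (parity (toℕ i))

  reflects-diagonal : ∀ {i j} → cycleAdj m i j → π i ≡ π j → i ≡ j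
  reflects-diagonal (inj₁ i≡j) _ = i≡j
  reflects-diagonal (inj₂ s) πi≡πj =
    contradiction (fromParity-injective πi≡πj) (cyclicSucc⇒parity≢ half-even s)

  injectiveᵘ : ∀ {i j j'} → cycleAdj m i j → cycleAdj m i j' → π j ≡ π j' → j ≡ j'
  injectiveᵘ (inj₁ refl) ij' eq = reflects-diagonal ij' eq
  injectiveᵘ ij (inj₁ refl) eq = sym (reflects-diagonal ij (sym eq))
  injectiveᵘ (inj₂ s) (inj₂ s') _ = cyclicSucc-functional s s'

  injectiveᵛ : ∀ {i i' j} → cycleAdj m i j → cycleAdj m i' j → π i ≡ π i' → i ≡ i'
  injectiveᵛ (inj₁ refl) i'j eq = sym (reflects-diagonal i'j (sym eq))
  injectiveᵛ ij (inj₁ refl) eq = reflects-diagonal ij eq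
  injectiveᵛ (inj₂ s) (inj₂ s') _ = cyclicSucc-injective s s'

4∣⇒parity[/2]≡0ℙ : ∀ {q} → 4 ∣ q → parity (q / 2) ≡ 0ℙ
4∣⇒parity[/2]≡0ℙ 4∣q = 2∣⇒parity≡0ℙ (m*n∣o⇒m∣o/n 2 2 4∣q)

cycleAdj? : ∀ m → Decidable (cycleAdj m)
cycleAdj? m i j =
  i Fin.≟ j ⊎-dec toℕ i ℕ.≟ suc (toℕ j) ⊎-dec toℕ i ℕ.≟ 0 ×-dec suc (toℕ j) ℕ.≟ m

all×? : ∀ {m n} {P : Fin m × Fin n → Set} → (∀ x → Dec (P x)) → Dec (∀ x → P x)
all×? P? = map′ (λ ∀P (a , b) → ∀P a b) (λ ∀P a b → ∀P (a , b))
  (all? λ a → all? λ b → P? (a , b))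

module _ (G₁ G₂ : BBGraph)
         (adj₁? : Decidable (BBGraph.Adj G₁)) (adj₂? : Decidable (BBGraph.Adj G₂)) where
  open BipGraph (G₁ ⋈ G₂) using (Adj)

  ⋈-adj? : Decidable Adj
  ⋈-adj? (a , b) (c , d) = a Fin.≟ c ×-dec adj₂? b d ⊎-dec b Fin.≟ d ×-dec adj₁? a c

  isStrongEdgeColouring? : ∀ {k} c → Dec (IsStrongEdgeColouring (G₁ ⋈ G₂) k c)
  isStrongEdgeColouring? c =
    all×? λ x → all×? λ x' → all×? λ y → all×? λ y' →
      ⋈-adj? x y →-dec ⋈-adj? x' y' →-dec ¬? (x ≟ x' ×-dec y ≟ y') →-dec
      (x ≟ x' ⊎-dec y ≟ y' ⊎-dec ⋈-adj? x y' ⊎-dec ⋈-adj? x' y) →-dec ¬? (c x y Fin.≟ c x' y')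
    where
    _≟_ : Decidable {A = Fin (BBGraph.n G₁) × Fin (BBGraph.n G₂)} _≡_
    _≟_ = ≡-dec Fin._≟_ Fin._≟_

-- Vertices of C 4 ⋈ C 4 are in ℤ₂², and x ~ y unless y = x + (1,1).  Two distinct edges are
-- far apart exactly when they are xy and (y + (1,1))(x + (1,1)); the colour is the direction
-- y − x together with a bit invariant under this involution.
colour₄ : Fin 2 × Fin 2 → Fin 2 × Fin 2 → Fin 6
colour₄ (a , b) (c , d) with a Fin.≟ c | b Fin.≟ d
... | no _  | _     = combine {m = 3} {n = 2} (# 0) a
... | yes _ | no _  = combine {m = 3} {n = 2} (# 1) b
... | yes _ | yes _ = combine {m = 3} {n = 2} (# 2) (if does (a Fin.≟ b) then # 0 else # 1)

χ'₂[C₄⋈C₄]≤6 : χ'₂≤ (C 4 ⋈ C 4) 6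
χ'₂[C₄⋈C₄]≤6 =
  colour₄ , from-yes (isStrongEdgeColouring? (C 4) (C 4) (cycleAdj? 2) (cycleAdj? 2) colour₄)

lemma4p3 : (q q' : ℕ) → 0 < q → 0 < q' → 4 ∣ q → 4 ∣ q' →
    χ'₂≤ (C q ⋈ C q') 6
lemma4p3 q q' _ _ 4∣q 4∣q' =
  χ'₂≤-pullback (⋈-localInjection (reduce q 4∣q) (reduce q' 4∣q')) χ'₂[C₄⋈C₄]≤6
  where
  reduce : ∀ p → 4 ∣ p → BBLocalInjection (C p) (C 4)
  reduce p 4∣p = parity-localInjection p (4∣⇒parity[/2]≡0ℙ 4∣p)
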